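{- Let $(U,\mathcal{D})$ be a tight interdependent orbit union such that every $\Lambda_{\mathcal{D}}(D)$, $D\in\mathcal{D}$, is a primitive permutation group. Then, for every $D\in\mathcal{D}$, $|\mathrm{Aut}_{\mathcal{D}}(U)|=|\Lambda_{\mathcal{D}}(D)|$.
   Context: All ordered sets are finite. A nonempty $A\subseteq P$ is order-autonomous if for every $z\in P\setminus A$: $z<a$ for some $a\in A$ implies $z$ below all of $A$, and $z>a$ for some $a\in A$ implies $z$ above all of $A$; nontrivial means $|A|\notin\{1,|P|\}$. A structured ordered set $(P,\mathcal{D})$ is an ordered set with a partition $\mathcal{D}$ of $P$ into antichains (frames); $\mathrm{Aut}_{\mathcal{D}}(P)$ is the group of automorphisms $\Phi$ with $\Phi[D]=D$ for all $D\in\mathcal{D}$, with orbits called $\mathcal{D}$-orbits. Distinct $\mathcal{D}$-orbits $C,E$ are directly interdependent if some $c\in C,e\in E$ satisfy $c<e$ or $e<c$ and some $c'\in C,e'\in E$ are incomparable. The orbit graph has the $\mathcal{D}$-orbits as vertices, adjacent iff directly interdependent; $(P,\mathcal{D})$ is an interdependent orbit union if this graph is connected, and tight if each frame is one $\mathcal{D}$-orbit and no frame contains a nontrivial order-autonomous antichain of $P$. $\Lambda_{\mathcal{D}}(D)=\{\Phi|_D:\Phi\in\mathrm{Aut}_{\mathcal{D}}(P)\}$. A permutation group is primitive if it has no blocks other than singletons and the whole set. -}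

module Defs where

open import Level using (0ℓ)
open import Data.Nat using (ℕ)
open import Data.Fin using (Fin)
open import Data.Fin.Subset using (Subset; _∈_; _∉_; ∣_∣)
open import Data.Product using (Σ; ∃; ∃-syntax; _×_; _,_; proj₁)
open import Data.Sum using (_⊎_)
open import Relation.Nullary using (¬_)
open import Relation.Binary.PropositionalEquality using (_≡_; _≢_)
open import Relation.Binary.Structures using (IsPartialOrder)
open import Relation.Binary.Construct.Closure.ReflexiveTransitive using (Star)

record FinPoset (n : ℕ) : Set₁ where
  field
    _≤_       : Fin n → Fin n → Set
    isPartialOrder : IsPartialOrder _≡_ _≤_

-- A structured ordered set (P, 𝒟): the partition 𝒟 into k frames is
-- given by a labelling  frame : Fin n → Fin k  such that every frame is
-- nonempty (surjectivity) and every frame is an antichain.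

record Structured (n k : ℕ) : Set₁ where
  field
    poset     : FinPoset n
  open FinPoset poset public
  field
    frame     : Fin n → Fin k
    nonempty  : (d : Fin k) → ∃[ x ] frame x ≡ d
    antichain : (x y : Fin n) → frame x ≡ frame y → x ≤ y → x ≡ y

module _ {n k : ℕ} (S : Structured n k) where
  open Structured S

  _<_ : Fin n → Fin n → Set
  x < y = x ≤ y × x ≢ y

  Incomparable : Fin n → Fin n → Set
  Incomparable x y = ¬ (x ≤ y) × ¬ (y ≤ x)

  record IsAut (Φ : Fin n → Fin n) : Set where
    field
      inv        : Fin n → Fin n
      inv-left   : ∀ x → inv (Φ x) ≡ x
      inv-right  : ∀ x → Φ (inv x) ≡ x
      mono       : ∀ x y → x ≤ y → Φ x ≤ Φ y
      reflect    : ∀ x y → Φ x ≤ Φ y → x ≤ y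
      preserves  : ∀ x → frame (Φ x) ≡ frame x

  Aut : Set
  Aut = Σ (Fin n → Fin n) IsAut

  _≈Aut_ : Aut → Aut → Set
  Φ ≈Aut Ψ = ∀ x → proj₁ Φ x ≡ proj₁ Ψ x

  SameOrbit : Fin n → Fin n → Set
  SameOrbit x y = Σ Aut λ Φ → proj₁ Φ x ≡ y

  DirectlyInterdependent : Fin n → Fin n → Set
  DirectlyInterdependent x y =
    ¬ SameOrbit x y
    × (∃[ c ] ∃[ e ] SameOrbit x c × SameOrbit y e × (c < e ⊎ e < c))
    × (∃[ c ] ∃[ e ] SameOrbit x c × SameOrbit y e × Incomparable c e)

  -- the orbit graph is connected: any two points lie in orbits joined by
  -- a path (steps inside one orbit, or between adjacent orbits).
  InterdependentOrbitUnion : Set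
  InterdependentOrbitUnion =
    ∀ x y → Star (λ a b → SameOrbit a b ⊎ DirectlyInterdependent a b) x y

  OrderAutonomous : Subset n → Set
  OrderAutonomous A =
    (∃[ a ] a ∈ A)
    × (∀ z → z ∉ A →
         (∀ a → a ∈ A → z < a → ∀ b → b ∈ A → z < b)
       × (∀ a → a ∈ A → a < z → ∀ b → b ∈ A → b < z))

  Tight : Set
  Tight =
    (∀ x y → frame x ≡ frame y → SameOrbit x y)
    × (∀ (d : Fin k) (A : Subset n) → (∀ x → x ∈ A → frame x ≡ d) →
         OrderAutonomous A → ∣ A ∣ ≡ 1 ⊎ ∣ A ∣ ≡ n)

  Elem : Fin k → Set
  Elem d = Σ (Fin n) λ x → frame x ≡ d

  -- Λ_𝒟(d) = { Φ|_d : Φ ∈ Aut_𝒟(P) }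
  Λ : Fin k → Set
  Λ d = Σ (Elem d → Elem d) λ g → Σ Aut λ Φ → ∀ x → proj₁ (g x) ≡ proj₁ Φ (proj₁ x)

  _≈Λ_ : {d : Fin k} → Λ d → Λ d → Set
  g ≈Λ h = ∀ x → proj₁ (proj₁ g x) ≡ proj₁ (proj₁ h x)

  IsBlock : (d : Fin k) → Subset n → Set
  IsBlock d B =
    (∀ x → x ∈ B → frame x ≡ d)
    × (∃[ b ] b ∈ B)
    × (∀ (g : Λ d) →
         (∀ (x : Elem d) → proj₁ x ∈ B → proj₁ (proj₁ g x) ∈ B)
       ⊎ (∀ (x : Elem d) → proj₁ x ∈ B → proj₁ (proj₁ g x) ∉ B))

  Primitive : Fin k → Set
  Primitive d = ∀ B → IsBlock d B → ∣ B ∣ ≡ 1 ⊎ (∀ x → frame x ≡ d → x ∈ B)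

-- Cardinality of a finite set presented as a type with an equality:
-- HasCard A _≈_ m  means A has exactly m elements up to ≈.

HasCard : (A : Set) → (A → A → Set) → ℕ → Set
HasCard A _≈_ m =
  Σ (Fin m → A) λ e → (∀ i j → e i ≈ e j → i ≡ j) × (∀ a → ∃[ i ] e i ≈ a)

{-# OPTIONS --safe #-}
-- Two automorphisms Φ, Ψ that agree on one frame agree everywhere.  Suppose they
-- agree on the frame of a, and the orbits of a and b are directly interdependent.
-- For z in the frame of b, the points of that frame related to the frame of a
-- exactly as Φ z is form a block B of Λ(frame b) containing Φ z and Ψ z.  B is
-- not the whole frame: since frames are orbits, some automorphism Φ' moves the
-- comparable pair c₀, e₀ to c₁, Φ' e₀, and Φ' e₀ would then relate to c₁ as the
-- incomparable e₁ does.  By primitivity B = {Φ z}, so Φ z = Ψ z, and connectivity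
-- of the orbit graph carries the agreement to every frame.  Hence restriction
-- Aut(U) → Λ(D) is a bijection.
module Submission where

open import Level using (0ℓ)
open import Data.Nat using (ℕ)
open import Data.Nat.Properties using (<-irrefl)
open import Data.Fin using (Fin; zero; suc)
open import Data.Fin.Properties using (_≟_; all?)
open import Data.Fin.Subset using (Subset; _∈_; _∉_; _⊂_; ∣_∣; ⁅_⁆)
open import Data.Fin.Subset.Properties using (x∈⁅y⁆⇒x≡y; p⊂q⇒∣p∣<∣q∣; ∣⁅x⁆∣≡1)
open import Data.Vec using (tabulate)
open import Data.Vec.Properties using (lookup∘tabulate; []=⇒lookup; lookup⇒[]=)
open import Data.Product using (_×_; _,_; proj₁; proj₂)
open import Data.Sum using (_⊎_; inj₁; inj₂)
open import Data.Empty using (⊥; ⊥-elim)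
open import Function using (_∘_)
open import Function.Bundles using (_⇔_; mk⇔; Equivalence)
open import Function.Definitions using (Bijective)
open import Function.Construct.Identity using (⇔-id)
open import Function.Construct.Symmetry using (⇔-sym)
open import Function.Construct.Composition using (_⇔-∘_)
open import Function.Properties.Equivalence using (⇔-setoid)
open import Relation.Nullary using (¬_; Dec; yes; no; does; _×-dec_; _→-dec_)
open import Relation.Nullary.Decidable using (dec-true; map′)
open import Relation.Nullary.Decidable.Core using (¬¬-excluded-middle; decidable-stable)
open import Relation.Nullary.Negation using (¬¬-map)
open import Relation.Binary.Definitions using (Decidable)
open import Relation.Binary.PropositionalEquality using (_≡_; refl; sym; trans; cong; subst)
open import Relation.Binary.Construct.Closure.ReflexiveTransitive using (Star; ε; _◅_)
import Relation.Binary.Reasoning.Setoid as SetoidReasoning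

open import Defs

module ⇔-Reasoning = SetoidReasoning (⇔-setoid 0ℓ)

¬¬-∀-Fin : ∀ {m} {P : Fin m → Set} → (∀ i → ¬ ¬ P i) → ¬ ¬ (∀ i → P i)
¬¬-∀-Fin {ℕ.zero} _   ¬∀ = ¬∀ λ ()
¬¬-∀-Fin {ℕ.suc m} ¬¬P ¬∀ = ¬¬P zero λ p₀ → ¬¬-∀-Fin (¬¬P ∘ suc) λ ps →
  ¬∀ λ { zero → p₀ ; (suc i) → ps i }

_⇔-dec_ : ∀ {A B : Set} → Dec A → Dec B → Dec (A ⇔ B)
A? ⇔-dec B? = map′ (λ (f , g) → mk⇔ f g) (λ A⇔B → Equivalence.to A⇔B , Equivalence.from A⇔B)
                   ((A? →-dec B?) ×-dec (B? →-dec A?))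

HasCard-bijective : ∀ {A B : Set} (_≈₁_ : A → A → Set) (_≈₂_ : B → B → Set) (f : A → B) {m} →
                    Bijective _≈₁_ _≈₂_ f → HasCard A _≈₁_ m → HasCard B _≈₂_ m
HasCard-bijective _ _ f (f-inj , f-surj) (e , e-inj , e-surj) =
  f ∘ e , (λ i j → e-inj i j ∘ f-inj) , λ b →
    let (a , fa≈b) = f-surj b ; (i , ei≈a) = e-surj a in i , fa≈b ei≈a

∣p∣≡1⇒≡ : ∀ {n} {p : Subset n} {x y} → x ∈ p → y ∈ p → ∣ p ∣ ≡ 1 → x ≡ y
∣p∣≡1⇒≡ {p = p} {x} {y} x∈p y∈p ∣p∣≡1 with x ≟ y
... | yes x≡y = x≡y
... | no x≢y = ⊥-elim (<-irrefl (trans (∣⁅x⁆∣≡1 x) (sym ∣p∣≡1)) (p⊂q⇒∣p∣<∣q∣ ⁅x⁆⊂p))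
  where
  ⁅x⁆⊂p : ⁅ x ⁆ ⊂ p
  ⁅x⁆⊂p = (λ z∈⁅x⁆ → subst (_∈ p) (sym (x∈⁅y⁆⇒x≡y x z∈⁅x⁆)) x∈p)
        , y , y∈p , λ y∈⁅x⁆ → x≢y (sym (x∈⁅y⁆⇒x≡y x y∈⁅x⁆))

module _ {n} {P : Fin n → Set} (P? : ∀ x → Dec (P x)) where

  satisfying : Subset n
  satisfying = tabulate (does ∘ P?)

  ∈-satisfying⁺ : ∀ {x} → P x → x ∈ satisfying
  ∈-satisfying⁺ {x} px =
    lookup⇒[]= x satisfying (trans (lookup∘tabulate (does ∘ P?) x) (dec-true (P? x) px))

  ∈-satisfying⁻ : ∀ {x} → x ∈ satisfying → P x
  ∈-satisfying⁻ {x} x∈ with P? x | trans (sym (lookup∘tabulate (does ∘ P?) x)) ([]=⇒lookup x∈)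
  ... | yes px | _ = px
  ... | no _   | ()

module _ {n k} (U : Structured n k) where
  open Structured U

  sameOrbit⇒sameFrame : ∀ {x y} → SameOrbit U x y → frame y ≡ frame x
  sameOrbit⇒sameFrame ((φ , isAut) , φx≡y) = trans (cong frame (sym φx≡y)) (IsAut.preserves isAut _)

  module _ (Φ : Aut U) where
    private φ = proj₁ Φ
    open IsAut (proj₂ Φ)

    frame-image : ∀ {x d} → frame x ≡ d → frame (φ x) ≡ d
    frame-image = trans (preserves _)

    frame-inv : ∀ x → frame (inv x) ≡ frame x
    frame-inv x = trans (sym (preserves (inv x))) (cong frame (inv-right x))

    ≤⇔image-≤ : ∀ {x y} → x ≤ y ⇔ φ x ≤ φ y
    ≤⇔image-≤ = mk⇔ (mono _ _) (reflect _ _)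

    ≤-image⇔inv-≤ : ∀ {c x} → c ≤ φ x ⇔ inv c ≤ x
    ≤-image⇔inv-≤ {c} {x} = begin
      c ≤ φ x           ≡⟨ cong (_≤ φ x) (sym (inv-right c)) ⟩
      φ (inv c) ≤ φ x   ≈⟨ ⇔-sym ≤⇔image-≤ ⟩
      inv c ≤ x         ∎
      where open ⇔-Reasoning

    image-≤⇔≤-inv : ∀ {c x} → φ x ≤ c ⇔ x ≤ inv c
    image-≤⇔≤-inv {c} {x} = begin
      φ x ≤ c           ≡⟨ cong (φ x ≤_) (sym (inv-right c)) ⟩
      φ x ≤ φ (inv c)   ≈⟨ ⇔-sym ≤⇔image-≤ ⟩
      x ≤ inv c         ∎
      where open ⇔-Reasoning

  AgreeOn : Fin k → Aut U → Aut U → Set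
  AgreeOn d Φ Ψ = ∀ z → frame z ≡ d → proj₁ Φ z ≡ proj₁ Ψ z

  SameProfile : Fin k → Fin n → Fin n → Set
  SameProfile d x y = ∀ c → frame c ≡ d → (c ≤ x ⇔ c ≤ y) × (x ≤ c ⇔ y ≤ c)

  SameProfile-refl : ∀ {d x} → SameProfile d x x
  SameProfile-refl _ _ = ⇔-id _ , ⇔-id _

  SameProfile-sym : ∀ {d x y} → SameProfile d x y → SameProfile d y x
  SameProfile-sym x∼y c fc = let (below , above) = x∼y c fc in ⇔-sym below , ⇔-sym above

  SameProfile-trans : ∀ {d x y w} → SameProfile d x y → SameProfile d y w → SameProfile d x w
  SameProfile-trans x∼y y∼w c fc =
    let (below₁ , above₁) = x∼y c fc ; (below₂ , above₂) = y∼w c fc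
    in below₂ ⇔-∘ below₁ , above₂ ⇔-∘ above₁

  SameProfile-image : ∀ (Φ : Aut U) {d x y} →
                      SameProfile d x y → SameProfile d (proj₁ Φ x) (proj₁ Φ y)
  SameProfile-image Φ {d} {x} {y} x∼y c fc = below , above
    where
    open IsAut (proj₂ Φ)
    open ⇔-Reasoning
    φ = proj₁ Φ
    inv-c∈d : frame (inv c) ≡ d
    inv-c∈d = trans (frame-inv Φ c) fc
    below : c ≤ φ x ⇔ c ≤ φ y
    below = begin
      c ≤ φ x       ≈⟨ ≤-image⇔inv-≤ Φ ⟩
      inv c ≤ x     ≈⟨ proj₁ (x∼y (inv c) inv-c∈d) ⟩
      inv c ≤ y     ≈⟨ ⇔-sym (≤-image⇔inv-≤ Φ) ⟩
      c ≤ φ y       ∎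
    above : φ x ≤ c ⇔ φ y ≤ c
    above = begin
      φ x ≤ c       ≈⟨ image-≤⇔≤-inv Φ ⟩
      x ≤ inv c     ≈⟨ proj₂ (x∼y (inv c) inv-c∈d) ⟩
      y ≤ inv c     ≈⟨ ⇔-sym (image-≤⇔≤-inv Φ) ⟩
      φ y ≤ c       ∎

  agreeOn⇒SameProfile : ∀ {d Φ Ψ} → AgreeOn d Φ Ψ →
                        ∀ z → SameProfile d (proj₁ Φ z) (proj₁ Ψ z)
  agreeOn⇒SameProfile {Φ = Φ} {Ψ} agree z c fc = below , above
    where
    open IsAut (proj₂ Φ)
    open ⇔-Reasoning
    ψ = proj₁ Ψ
    ψ-inv≡ : ψ (inv c) ≡ c
    ψ-inv≡ = trans (sym (agree (inv c) (trans (frame-inv Φ c) fc))) (inv-right c)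
    below : c ≤ proj₁ Φ z ⇔ c ≤ ψ z
    below = begin
      c ≤ proj₁ Φ z         ≈⟨ ≤-image⇔inv-≤ Φ ⟩
      inv c ≤ z             ≈⟨ ≤⇔image-≤ Ψ ⟩
      ψ (inv c) ≤ ψ z       ≡⟨ cong (_≤ ψ z) ψ-inv≡ ⟩
      c ≤ ψ z               ∎
    above : proj₁ Φ z ≤ c ⇔ ψ z ≤ c
    above = begin
      proj₁ Φ z ≤ c         ≈⟨ image-≤⇔≤-inv Φ ⟩
      z ≤ inv c             ≈⟨ ≤⇔image-≤ Ψ ⟩
      ψ z ≤ ψ (inv c)       ≡⟨ cong (ψ z ≤_) ψ-inv≡ ⟩
      ψ z ≤ c               ∎

  uniformProfile⇒¬interdependent :
    (∀ x y → frame x ≡ frame y → SameOrbit U x y) →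
    ∀ {a b w} → (∀ y → frame y ≡ frame b → SameProfile (frame a) w y) →
    ¬ DirectlyInterdependent U a b
  uniformProfile⇒¬interdependent sameFrame⇒sameOrbit {a} uniform
    (_ , (c₀ , e₀ , a∼c₀ , b∼e₀ , c₀⋚e₀) , (c₁ , e₁ , a∼c₁ , b∼e₁ , c₁≰e₁ , e₁≰c₁))
    with sameFrame⇒sameOrbit c₀ c₁
           (trans (sameOrbit⇒sameFrame a∼c₀) (sym (sameOrbit⇒sameFrame a∼c₁)))
  ... | Φ , φc₀≡c₁ = compare c₀⋚e₀
    where
    φ = proj₁ Φ
    open IsAut (proj₂ Φ)
    φe₀∼e₁ : SameProfile (frame a) (φ e₀) e₁
    φe₀∼e₁ = SameProfile-trans
      (SameProfile-sym (uniform (φ e₀) (frame-image Φ (sameOrbit⇒sameFrame b∼e₀))))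
      (uniform e₁ (sameOrbit⇒sameFrame b∼e₁))
    profile-at-c₁ : (c₁ ≤ φ e₀ ⇔ c₁ ≤ e₁) × (φ e₀ ≤ c₁ ⇔ e₁ ≤ c₁)
    profile-at-c₁ = φe₀∼e₁ c₁ (sameOrbit⇒sameFrame a∼c₁)
    compare : _<_ U c₀ e₀ ⊎ _<_ U e₀ c₀ → ⊥
    compare (inj₁ (c₀≤e₀ , _)) =
      c₁≰e₁ (Equivalence.to (proj₁ profile-at-c₁) (subst (_≤ φ e₀) φc₀≡c₁ (mono _ _ c₀≤e₀)))
    compare (inj₂ (e₀≤c₀ , _)) =
      e₁≰c₁ (Equivalence.to (proj₂ profile-at-c₁) (subst (φ e₀ ≤_) φc₀≡c₁ (mono _ _ e₀≤c₀)))

  module _ (_≤?_ : Decidable _≤_) where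

    SameProfile? : ∀ d x y → Dec (SameProfile d x y)
    SameProfile? d x y = all? λ c →
      (frame c ≟ d) →-dec (((c ≤? x) ⇔-dec (c ≤? y)) ×-dec ((x ≤? c) ⇔-dec (y ≤? c)))

    profileClass : Fin k → Fin k → Fin n → Subset n
    profileClass d e w = satisfying (λ y → SameProfile? d w y ×-dec (frame y ≟ e))

    ∈-profileClass⁺ : ∀ d w {e y} → SameProfile d w y → frame y ≡ e → y ∈ profileClass d e w
    ∈-profileClass⁺ d w {e} w∼y fy =
      ∈-satisfying⁺ (λ y → SameProfile? d w y ×-dec (frame y ≟ e)) (w∼y , fy)

    ∈-profileClass⁻ : ∀ {d e w y} → y ∈ profileClass d e w → SameProfile d w y × frame y ≡ e
    ∈-profileClass⁻ {d} {e} {w} = ∈-satisfying⁻ (λ y → SameProfile? d w y ×-dec (frame y ≟ e))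

    profileClass-isBlock : ∀ d {e} w → frame w ≡ e → IsBlock U e (profileClass d e w)
    profileClass-isBlock d {e} w fw≡e =
      (λ x x∈B → proj₂ (∈-profileClass⁻ x∈B))
      , (w , ∈-profileClass⁺ d w SameProfile-refl fw≡e)
      , block
      where
      B = profileClass d e w
      block : ∀ (g : Λ U e) →
                (∀ (x : Elem U e) → proj₁ x ∈ B → proj₁ (proj₁ g x) ∈ B)
              ⊎ (∀ (x : Elem U e) → proj₁ x ∈ B → proj₁ (proj₁ g x) ∉ B)
      block (g , Φ , g≗Φ) with SameProfile? d w (proj₁ Φ w)
      ... | yes w∼φw = inj₁ λ (x , fx) x∈B →
        let (w∼x , _) = ∈-profileClass⁻ x∈B
        in subst (_∈ B) (sym (g≗Φ (x , fx)))
             (∈-profileClass⁺ d w (SameProfile-trans w∼φw (SameProfile-image Φ w∼x))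
                                  (frame-image Φ fx))
      ... | no w≁φw = inj₂ λ (x , fx) x∈B gx∈B →
        let (w∼x , _) = ∈-profileClass⁻ x∈B
            (w∼φx , _) = ∈-profileClass⁻ (subst (_∈ B) (g≗Φ (x , fx)) gx∈B)
        in w≁φw (SameProfile-trans w∼φx (SameProfile-sym (SameProfile-image Φ w∼x)))

    module _ (sameFrame⇒sameOrbit : ∀ x y → frame x ≡ frame y → SameOrbit U x y)
             (allPrimitive : ∀ d → Primitive U d) {Φ Ψ : Aut U} where

      agreeOn-spreads : ∀ {a b} → DirectlyInterdependent U a b →
                        AgreeOn (frame a) Φ Ψ → AgreeOn (frame b) Φ Ψ
      agreeOn-spreads {a} {b} a⋈b agree z fz
        with allPrimitive (frame b) _
               (profileClass-isBlock (frame a) (proj₁ Φ z) (frame-image Φ fz))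
      ... | inj₁ ∣B∣≡1 =
        ∣p∣≡1⇒≡ (∈-profileClass⁺ (frame a) (proj₁ Φ z) SameProfile-refl (frame-image Φ fz))
                (∈-profileClass⁺ (frame a) (proj₁ Φ z) (agreeOn⇒SameProfile {Φ = Φ} {Ψ} agree z)
                                 (frame-image Ψ fz))
                ∣B∣≡1
      ... | inj₂ B-full = ⊥-elim (uniformProfile⇒¬interdependent sameFrame⇒sameOrbit
                                    (λ y fy → proj₁ (∈-profileClass⁻ (B-full y fy))) a⋈b)

      agreeOn-spreads-along :
        ∀ {a b} → Star (λ x y → SameOrbit U x y ⊎ DirectlyInterdependent U x y) a b →
        AgreeOn (frame a) Φ Ψ → AgreeOn (frame b) Φ Ψ
      agreeOn-spreads-along ε agree = agree
      agreeOn-spreads-along (inj₁ a∼c ◅ path) agree =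
        agreeOn-spreads-along path
          (subst (λ d → AgreeOn d Φ Ψ) (sym (sameOrbit⇒sameFrame a∼c)) agree)
      agreeOn-spreads-along (inj₂ a⋈c ◅ path) agree =
        agreeOn-spreads-along path (agreeOn-spreads a⋈c agree)

  -- Equality in Fin n is decidable, hence ¬¬-stable, so we may assume _≤_
  -- decidable; that is what makes the profile classes subsets.
  agreeOn⇒≈Aut : Tight U → InterdependentOrbitUnion U → (∀ d → Primitive U d) →
                 ∀ {d Φ Ψ} → AgreeOn d Φ Ψ → _≈Aut_ U Φ Ψ
  agreeOn⇒≈Aut (sameFrame⇒sameOrbit , _) connected allPrimitive {d} {Φ} {Ψ} agree x =
    decidable-stable (proj₁ Φ x ≟ proj₁ Ψ x) (¬¬-map agreeAt-x ¬¬-decidable)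
    where
    ¬¬-decidable : ¬ ¬ Decidable _≤_
    ¬¬-decidable = ¬¬-∀-Fin λ _ → ¬¬-∀-Fin λ _ → ¬¬-excluded-middle
    x₀ : Fin n
    x₀ = proj₁ (nonempty d)
    agreeAt-x : Decidable _≤_ → proj₁ Φ x ≡ proj₁ Ψ x
    agreeAt-x _≤?_ =
      agreeOn-spreads-along _≤?_ sameFrame⇒sameOrbit allPrimitive {Φ} {Ψ} (connected x₀ x)
        (λ z fz → agree z (trans fz (proj₂ (nonempty d)))) x refl

  restrict : ∀ d → Aut U → Λ U d
  restrict d Φ = (λ (x , fx) → proj₁ Φ x , frame-image Φ fx) , Φ , λ _ → refl

  extend : ∀ {d} → Λ U d → Aut U
  extend = proj₁ ∘ proj₂

  module _ (tight : Tight U) (connected : InterdependentOrbitUnion U)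
           (allPrimitive : ∀ d → Primitive U d) (d : Fin k) where

    restrict-bijective : Bijective (_≈Aut_ U) (_≈Λ_ U) (restrict d)
    restrict-bijective =
      (λ {Φ} {Ψ} restrictions≈ → agreeOn⇒≈Aut tight connected allPrimitive {d} {Φ} {Ψ}
                                   λ z fz → restrictions≈ (z , fz))
      , λ (g , Φ , g≗Φ) → Φ , λ Ψ≈Φ x → trans (Ψ≈Φ (proj₁ x)) (sym (g≗Φ x))

    extend-bijective : Bijective (_≈Λ_ U) (_≈Aut_ U) (extend {d})
    extend-bijective =
      (λ {(_ , _ , g≗Φ)} {(_ , _ , h≗Ψ)} Φ≈Ψ x →
          trans (g≗Φ x) (trans (Φ≈Ψ (proj₁ x)) (sym (h≗Ψ x))))
      , λ Φ → restrict d Φ , λ {(_ , Ψ , g≗Ψ)} g≈ →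
          agreeOn⇒≈Aut tight connected allPrimitive {d} {Ψ} {Φ}
            λ z fz → trans (sym (g≗Ψ (z , fz))) (g≈ (z , fz))

proposition9p1 : ∀ {n k} (U : Structured n k) →
    Tight U → InterdependentOrbitUnion U →
    (∀ d → Primitive U d) →
    ∀ (d : Fin k) (m : ℕ) → HasCard (Aut U) (_≈Aut_ U) m ⇔ HasCard (Λ U d) (_≈Λ_ U) m
proposition9p1 U tight connected allPrimitive d m =
  mk⇔ (HasCard-bijective (_≈Aut_ U) (_≈Λ_ U) (restrict U d)
                         (restrict-bijective U tight connected allPrimitive d))
      (HasCard-bijective (_≈Λ_ U) (_≈Aut_ U) (extend U)
                         (extend-bijective U tight connected allPrimitive d))
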